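{- Let $\varphi(P_1,\ldots,P_\ell)$ be an MSO sentence over a finite alphabet $A$ using monadic predicate symbols $P_1,\ldots,P_\ell$, and let $\mathbf{P}_1,\ldots,\mathbf{P}_\ell$ be monadic predicates such that the language $L_{\varphi,\mathbf{P}_1,\ldots,\mathbf{P}_\ell}$ is regular. Then there exist regular monadic predicates $\mathbf{Q}_1,\ldots,\mathbf{Q}_\ell$ such that $L_{\varphi,\mathbf{Q}_1,\ldots,\mathbf{Q}_\ell} = L_{\varphi,\mathbf{P}_1,\ldots,\mathbf{P}_\ell}$.
   Context: A monadic predicate is a family $\mathbf{P} = (\mathbf{P}_n)_{n\in\mathbb{N}}$ with $\mathbf{P}_n \subseteq \{0,\ldots,n-1\}$ (arbitrary, non-uniform). MSO formulae over words $u = u_0\cdots u_{n-1}$ are built from $\mathbf{a}(x)$ ($a\in A$), $x\le y$, $P(x)$, Boolean connectives and first-order and monadic second-order quantification over positions; on a word of length $n$, $P(x)$ holds iff $x \in \mathbf{P}_n$ where $\mathbf{P}$ interprets $P$. For a sentence $\varphi$ and predicates $\mathbf{P}_1,\ldots,\mathbf{P}_\ell$, $L_{\varphi,\mathbf{P}_1,\ldots,\mathbf{P}_\ell} = \{u\in A^* \mid u,\mathbf{P}_1,\ldots,\mathbf{P}_\ell\models\varphi\}$. A monadic predicate $\mathbf{Q}$ is regular if there is an MSO formula $\psi(x)$ (without predicate symbols) over the one-letter alphabet $\{a\}$ such that $\mathbf{Q}_n = \{x \in\{0,\ldots,n-1\}\mid a^n,x\models\psi\}$ for all $n$; equivalently,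 $\mathbf{Q}$ is a Boolean combination of the predicates $\{c\}$, $(\{n-1-c\})_{n}$, $\{x \mid x\equiv r \bmod q\}$, and $(\{x \mid n-1 \equiv r \bmod q\})_n$ for constants $c,q,r\in\mathbb{N}$; equivalently, the language $\{w_n \mid n\in\mathbb{N}\}\subseteq\{0,1\}^*$, where $w_n$ is the characteristic word of $\mathbf{Q}_n$ of length $n$, is regular. -}

module Defs where

open import Data.Nat using (ℕ; zero; suc)
open import Data.Fin using (Fin; zero; suc; toℕ; _≤_)
open import Data.Bool using (Bool; true)
open import Data.List using (List; length; lookup; replicate)
open import Data.Product using (Σ; _×_)
open import Data.Sum using (_⊎_)
open import Relation.Nullary using (¬_)
open import Relation.Binary.PropositionalEquality using (_≡_)
open import Function.Bundles using (_⇔_)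

Word : ℕ → Set
Word k = List (Fin k)

-- A monadic predicate: for every length n, a subset of {0,…,n-1},
-- given by its characteristic function.
MonPred : Set
MonPred = (n : ℕ) → Fin n → Bool

-- MSO formulae over alphabet Fin k with ℓ monadic predicate symbols P_0..P_{ℓ-1},
-- f free first-order variables and s free second-order variables (de Bruijn).
data Formula (k ℓ : ℕ) : ℕ → ℕ → Set where
  letter : ∀ {f s} → Fin k → Fin f → Formula k ℓ f s
  leq    : ∀ {f s} → Fin f → Fin f → Formula k ℓ f s
  pred   : ∀ {f s} → Fin ℓ → Fin f → Formula k ℓ f s
  mem    : ∀ {f s} → Fin f → Fin s → Formula k ℓ f s
  neg    : ∀ {f s} → Formula k ℓ f s → Formula k ℓ f s
  and    : ∀ {f s} → Formula k ℓ f s → Formula k ℓ f s → Formula k ℓ f s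
  or     : ∀ {f s} → Formula k ℓ f s → Formula k ℓ f s → Formula k ℓ f s
  ex1    : ∀ {f s} → Formula k ℓ (suc f) s → Formula k ℓ f s
  all1   : ∀ {f s} → Formula k ℓ (suc f) s → Formula k ℓ f s
  ex2    : ∀ {f s} → Formula k ℓ f (suc s) → Formula k ℓ f s
  all2   : ∀ {f s} → Formula k ℓ f (suc s) → Formula k ℓ f s

Sentence : ℕ → ℕ → Set
Sentence k ℓ = Formula k ℓ 0 0

ext : ∀ {m} {B : Set} → B → (Fin m → B) → Fin (suc m) → B
ext b ρ zero    = b
ext b ρ (suc i) = ρ i

Sat : ∀ {k ℓ f s} (u : Word k) (P : Fin ℓ → MonPred) →
      (Fin f → Fin (length u)) → (Fin s → Fin (length u) → Bool) →
      Formula k ℓ f s → Set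
Sat u P ρ σ (letter a x) = lookup u (ρ x) ≡ a
Sat u P ρ σ (leq x y)    = ρ x ≤ ρ y
Sat u P ρ σ (pred i x)   = P i (length u) (ρ x) ≡ true
Sat u P ρ σ (mem x X)    = σ X (ρ x) ≡ true
Sat u P ρ σ (neg φ)      = ¬ Sat u P ρ σ φ
Sat u P ρ σ (and φ ψ)    = Sat u P ρ σ φ × Sat u P ρ σ ψ
Sat u P ρ σ (or φ ψ)     = Sat u P ρ σ φ ⊎ Sat u P ρ σ ψ
Sat u P ρ σ (ex1 φ)      = Σ (Fin (length u)) λ p → Sat u P (ext p ρ) σ φ
Sat u P ρ σ (all1 φ)     = (p : Fin (length u)) → Sat u P (ext p ρ) σ φ
Sat u P ρ σ (ex2 φ)      = Σ (Fin (length u) → Bool) λ X → Sat u P ρ (ext X σ) φ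
Sat u P ρ σ (all2 φ)     = (X : Fin (length u) → Bool) → Sat u P ρ (ext X σ) φ

emptyVal : ∀ {B : Set} → Fin 0 → B
emptyVal ()

Language : ℕ → Set₁
Language k = Word k → Set

Lang : ∀ {k ℓ} → Sentence k ℓ → (Fin ℓ → MonPred) → Language k
Lang φ P u = Sat u P emptyVal emptyVal φ

record DFA (k : ℕ) : Set where
  field
    states : ℕ
    start  : Fin states
    δ      : Fin states → Fin k → Fin states
    final  : Fin states → Bool

run : ∀ {k} (D : DFA k) → Fin (DFA.states D) → Word k → Fin (DFA.states D)
run D q List.[]       = q
run D q (a List.∷ w)  = run D (DFA.δ D q a) w

accepts : ∀ {k} → DFA k → Word k → Set
accepts D w = DFA.final D (run D (DFA.start D) w) ≡ true

Regular : ∀ {k} → Language k → Set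
Regular {k} L = Σ (DFA k) λ D → (u : Word k) → L u ⇔ accepts D u

RegularPred : MonPred → Set
RegularPred Q =
  Σ (Formula 1 0 1 0) λ ψ →
    (n : ℕ) (x : Fin n) →
      (Q n x ≡ true) ⇔
      Sat (replicate n zero) emptyVal (λ _ → cast n x) emptyVal ψ
  where
    open import Data.List.Properties using (length-replicate)
    open import Data.Fin using () renaming (cast to fcast)
    open import Relation.Binary.PropositionalEquality using (sym)
    cast : (n : ℕ) → Fin n → Fin (length (replicate n (zero {0})))
    cast n x = fcast (sym (length-replicate n)) x

-- Fix a DFA D for L_{φ,P}. Call an ℓ-tuple X of subsets of {0,…,N-1} good if,
-- interpreting the predicate symbols by X, φ agrees with D on all words of
-- length N; the restriction of P to length N is good. Goodness is MSO-definable
-- over the one-letter alphabet with X free: quantify over all words of length N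
-- as partitions of the positions into letter sets, turn the letters and
-- predicate symbols of φ into set variables, and express acceptance by D by
-- guessing its run. The lexicographic order on tuples is MSO-definable and
-- well-founded, so every length has a unique least good tuple, found by
-- descent since MSO is decidable on finite structures; "x lies in the i-th set
-- of the least good tuple" then defines a regular Q_i, and L_{φ,Q} = L_{φ,P}
-- because that tuple is good.

module Submission where

open import Defs
open import Data.Bool using (Bool; true; false; f<t) renaming (_<_ to _<ᴮ_)
import Data.Bool.Properties as Bool
open import Data.Empty using (⊥-elim)
open import Data.Fin as Fin using (Fin; zero; suc; toℕ; _↑ˡ_; _↑ʳ_; fromℕ; fromℕ<)
import Data.Fin.Properties as Fin
open import Data.Fin.Induction using (<-weakInduction)
open import Data.Fin.Subset.Properties using (anySubset?)
open import Data.List using (length; lookup; tabulate; replicate)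
import Data.List.Properties as List
open import Data.Nat as ℕ using (ℕ; zero; suc; _+_; z≤n; s≤s)
import Data.Nat.Properties as ℕ
open import Data.Product using (Σ; ∃; ∃-syntax; _×_; _,_; proj₁; proj₂)
open import Data.Product.Function.NonDependent.Propositional using (_×-⇔_)
open import Data.Sum using (_⊎_; inj₁; inj₂)
open import Data.Sum.Function.Propositional using (_⊎-⇔_)
import Data.Vec as Vec
import Data.Vec.Properties as Vec
open import Data.Vec.Functional using (_++_)
open import Data.Vec.Functional.Properties using (lookup-++ˡ; lookup-++ʳ)
open import Data.Vec.Relation.Binary.Lex.Strict as Lex using (Lex-<; this; next; base)
open import Data.Vec.Relation.Binary.Pointwise.Inductive as Pointwise using (Pointwise)
open import Induction.WellFounded using (WellFounded; Acc; acc)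
import Relation.Binary.Construct.On as On
open import Relation.Binary.Definitions using (tri<; tri≈; tri>)
open import Function using (_∘_; id)
open import Function.Bundles using (_⇔_; mk⇔; Equivalence)
import Function.Properties.Equivalence as ⇔
open import Function.Related.TypeIsomorphisms using (→-cong-⇔; ¬-cong-⇔)
open import Relation.Binary.PropositionalEquality
open import Relation.Nullary using (¬_; Dec; yes; no; ¬?)
import Relation.Nullary.Decidable as Dec
open import Relation.Nullary.Decidable using (_×-dec_; _⊎-dec_; decidable-stable)

open Equivalence using (to; from)

Σ-cong-⇔ : {A : Set} {B C : A → Set} → (∀ x → B x ⇔ C x) → Σ A B ⇔ Σ A C
Σ-cong-⇔ e = mk⇔ (λ (x , b) → x , to (e x) b) (λ (x , c) → x , from (e x) c)

Π-cong-⇔ : {A : Set} {B C : A → Set} → (∀ x → B x ⇔ C x) → ((x : A) → B x) ⇔ ((x : A) → C x)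
Π-cong-⇔ e = mk⇔ (λ f x → to (e x) (f x)) (λ f x → from (e x) (f x))

≡-congˡ-⇔ : {A : Set} {b c d : A} → b ≡ c → (b ≡ d) ⇔ (c ≡ d)
≡-congˡ-⇔ refl = ⇔.refl

≡-true-injective : {b c : Bool} → (b ≡ true) ⇔ (c ≡ true) → b ≡ c
≡-true-injective {false} {false} _ = refl
≡-true-injective {false} {true}  e = from e refl
≡-true-injective {true}  {false} e = sym (to e refl)
≡-true-injective {true}  {true}  _ = refl

isYes≡true⇔ : {P : Set} (P? : Dec P) → (Dec.isYes P? ≡ true) ⇔ P
isYes≡true⇔ P? = ⇔.trans (⇔.sym Bool.T-≡) (mk⇔ Dec.toWitness Dec.fromWitness)

infix 4 _≗₂_
_≗₂_ : {A B C : Set} → (A → B → C) → (A → B → C) → Set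
f ≗₂ g = ∀ x → f x ≗ g x

≗₂-sym : {A B C : Set} {f g : A → B → C} → f ≗₂ g → g ≗₂ f
≗₂-sym f≗g x y = sym (f≗g x y)

ext-cong : ∀ {m} {B : Set} (b : B) {ρ ρ′ : Fin m → B} → ρ ≗ ρ′ → ext b ρ ≗ ext b ρ′
ext-cong b e zero    = refl
ext-cong b e (suc i) = e i

ext-cong₂ : ∀ {m} {B C : Set} (b : B → C) {σ σ′ : Fin m → B → C} → σ ≗₂ σ′ → ext b σ ≗₂ ext b σ′
ext-cong₂ b e zero    _ = refl
ext-cong₂ b e (suc i) y = e i y

ext-++ : ∀ {m n} {B : Set} (xs : Fin (suc m) → B) (ys : Fin n → B) →
         ext (xs zero) (xs ∘ suc ++ ys) ≗ xs ++ ys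
ext-++     xs ys zero    = refl
ext-++ {m} xs ys (suc i) with Fin.splitAt m i
... | inj₁ _ = refl
... | inj₂ _ = refl

∀-≡-elim : {A : Set} {P : A → Set} (b : A) → (∀ a → b ≡ a → P a) ⇔ P b
∀-≡-elim b = mk⇔ (λ h → h b refl) (λ { p _ refl → p })

-- Satisfaction on labelled finite linear orders

-- Sat with the word given only by its letter function on Fin N, so that the
-- structures built below need not be lists of the right length.
module _ {k ℓ N : ℕ} (lab : Fin N → Fin k) (pr : Fin ℓ → Fin N → Bool) where

  SatOn : ∀ {f s} → (Fin f → Fin N) → (Fin s → Fin N → Bool) → Formula k ℓ f s → Set
  SatOn ρ σ (letter a x) = lab (ρ x) ≡ a
  SatOn ρ σ (leq x y)    = ρ x Fin.≤ ρ y
  SatOn ρ σ (pred i x)   = pr i (ρ x) ≡ true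
  SatOn ρ σ (mem x X)    = σ X (ρ x) ≡ true
  SatOn ρ σ (neg φ)      = ¬ SatOn ρ σ φ
  SatOn ρ σ (and φ ψ)    = SatOn ρ σ φ × SatOn ρ σ ψ
  SatOn ρ σ (or φ ψ)     = SatOn ρ σ φ ⊎ SatOn ρ σ ψ
  SatOn ρ σ (ex1 φ)      = Σ (Fin N) λ p → SatOn (ext p ρ) σ φ
  SatOn ρ σ (all1 φ)     = (p : Fin N) → SatOn (ext p ρ) σ φ
  SatOn ρ σ (ex2 φ)      = Σ (Fin N → Bool) λ X → SatOn ρ (ext X σ) φ
  SatOn ρ σ (all2 φ)     = (X : Fin N → Bool) → SatOn ρ (ext X σ) φ

Sat⇔SatOn : ∀ {k ℓ f s} (u : Word k) (P : Fin ℓ → MonPred) ρ σ (φ : Formula k ℓ f s) →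
            Sat u P ρ σ φ ⇔ SatOn (lookup u) (λ i → P i (length u)) ρ σ φ
Sat⇔SatOn u P ρ σ (letter a x) = ⇔.refl
Sat⇔SatOn u P ρ σ (leq x y)    = ⇔.refl
Sat⇔SatOn u P ρ σ (pred i x)   = ⇔.refl
Sat⇔SatOn u P ρ σ (mem x X)    = ⇔.refl
Sat⇔SatOn u P ρ σ (neg φ)      = ¬-cong-⇔ (Sat⇔SatOn u P ρ σ φ)
Sat⇔SatOn u P ρ σ (and φ ψ)    = Sat⇔SatOn u P ρ σ φ ×-⇔ Sat⇔SatOn u P ρ σ ψ
Sat⇔SatOn u P ρ σ (or φ ψ)     = Sat⇔SatOn u P ρ σ φ ⊎-⇔ Sat⇔SatOn u P ρ σ ψ
Sat⇔SatOn u P ρ σ (ex1 φ)      = Σ-cong-⇔ λ p → Sat⇔SatOn u P (ext p ρ) σ φ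
Sat⇔SatOn u P ρ σ (all1 φ)     = Π-cong-⇔ λ p → Sat⇔SatOn u P (ext p ρ) σ φ
Sat⇔SatOn u P ρ σ (ex2 φ)      = Σ-cong-⇔ λ X → Sat⇔SatOn u P ρ (ext X σ) φ
Sat⇔SatOn u P ρ σ (all2 φ)     = Π-cong-⇔ λ X → Sat⇔SatOn u P ρ (ext X σ) φ

module _ {k ℓ N : ℕ} {lab lab′ : Fin N → Fin k} {pr pr′ : Fin ℓ → Fin N → Bool}
         (lab≗ : lab ≗ lab′) (pr≗ : pr ≗₂ pr′) where

  SatOn-cong : ∀ {f s} {ρ ρ′ : Fin f → Fin N} {σ σ′ : Fin s → Fin N → Bool} →
               ρ ≗ ρ′ → σ ≗₂ σ′ → (φ : Formula k ℓ f s) →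
               SatOn lab pr ρ σ φ ⇔ SatOn lab′ pr′ ρ′ σ′ φ
  SatOn-cong ρ≗ σ≗ (letter a x) = ≡-congˡ-⇔ (trans (cong lab (ρ≗ x)) (lab≗ _))
  SatOn-cong ρ≗ σ≗ (leq x y) = mk⇔ (subst₂ Fin._≤_ (ρ≗ x) (ρ≗ y)) (subst₂ Fin._≤_ (sym (ρ≗ x)) (sym (ρ≗ y)))
  SatOn-cong ρ≗ σ≗ (pred i x) = ≡-congˡ-⇔ (trans (cong (pr i) (ρ≗ x)) (pr≗ i _))
  SatOn-cong {σ = σ} ρ≗ σ≗ (mem x X) = ≡-congˡ-⇔ (trans (cong (σ X) (ρ≗ x)) (σ≗ X _))
  SatOn-cong ρ≗ σ≗ (neg φ)   = ¬-cong-⇔ (SatOn-cong ρ≗ σ≗ φ)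
  SatOn-cong ρ≗ σ≗ (and φ ψ) = SatOn-cong ρ≗ σ≗ φ ×-⇔ SatOn-cong ρ≗ σ≗ ψ
  SatOn-cong ρ≗ σ≗ (or φ ψ)  = SatOn-cong ρ≗ σ≗ φ ⊎-⇔ SatOn-cong ρ≗ σ≗ ψ
  SatOn-cong ρ≗ σ≗ (ex1 φ)   = Σ-cong-⇔ λ p → SatOn-cong (ext-cong p ρ≗) σ≗ φ
  SatOn-cong ρ≗ σ≗ (all1 φ)  = Π-cong-⇔ λ p → SatOn-cong (ext-cong p ρ≗) σ≗ φ
  SatOn-cong ρ≗ σ≗ (ex2 φ)   = Σ-cong-⇔ λ X → SatOn-cong ρ≗ (ext-cong₂ X σ≗) φ
  SatOn-cong ρ≗ σ≗ (all2 φ)  = Π-cong-⇔ λ X → SatOn-cong ρ≗ (ext-cong₂ X σ≗) φ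

SatOn-cast : ∀ {k ℓ f s M N} (M≡N : M ≡ N) (lab : Fin M → Fin k) (pr : (n : ℕ) → Fin ℓ → Fin n → Bool)
             ρ σ (φ : Formula k ℓ f s) →
             SatOn lab (pr M) ρ σ φ ⇔
             SatOn (lab ∘ Fin.cast (sym M≡N)) (pr N) (Fin.cast M≡N ∘ ρ) (λ j → σ j ∘ Fin.cast (sym M≡N)) φ
SatOn-cast refl lab pr ρ σ φ = SatOn-cong (λ y → cong lab (sym (cast-id y))) (λ _ _ → refl)
                                          (λ j → sym (cast-id (ρ j))) (λ j y → cong (σ j) (sym (cast-id y))) φ
  where cast-id = Fin.cast-is-id refl

∃-set? : ∀ {N} {P : (Fin N → Bool) → Set} → (∀ {X Y} → X ≗ Y → P X → P Y) →
         (∀ X → Dec (P X)) → Dec (∃ P)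
∃-set? P-resp P? = Dec.map (mk⇔ (λ (S , p) → Vec.lookup S , p)
                               (λ (X , p) → Vec.tabulate X , P-resp (sym ∘ Vec.lookup∘tabulate X) p))
                          (anySubset? (P? ∘ Vec.lookup))

∀-set? : ∀ {N} {P : (Fin N → Bool) → Set} → (∀ {X Y} → X ≗ Y → P X → P Y) →
         (∀ X → Dec (P X)) → Dec (∀ X → P X)
∀-set? P-resp P? = Dec.map (mk⇔ (λ ∄¬P X → decidable-stable (P? X) (λ ¬p → ∄¬P (X , ¬p)))
                               (λ ∀P (X , ¬p) → ¬p (∀P X)))
                          (¬? (∃-set? (λ X≗Y ¬p → ¬p ∘ P-resp (sym ∘ X≗Y)) (¬? ∘ P?)))

renameFO : ∀ {k ℓ f f′ s} → (Fin f → Fin f′) → Formula k ℓ f s → Formula k ℓ f′ s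
renameFO r (letter a x) = letter a (r x)
renameFO r (leq x y)    = leq (r x) (r y)
renameFO r (pred i x)   = pred i (r x)
renameFO r (mem x X)    = mem (r x) X
renameFO r (neg φ)      = neg (renameFO r φ)
renameFO r (and φ ψ)    = and (renameFO r φ) (renameFO r ψ)
renameFO r (or φ ψ)     = or (renameFO r φ) (renameFO r ψ)
renameFO r (ex1 φ)      = ex1 (renameFO (Fin.lift 1 r) φ)
renameFO r (all1 φ)     = all1 (renameFO (Fin.lift 1 r) φ)
renameFO r (ex2 φ)      = ex2 (renameFO r φ)
renameFO r (all2 φ)     = all2 (renameFO r φ)

module _ {k ℓ N : ℕ} (lab : Fin N → Fin k) (pr : Fin ℓ → Fin N → Bool) where

  SatOn-renameFO : ∀ {f f′ s} (r : Fin f → Fin f′) ρ σ (φ : Formula k ℓ f s) →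
                   SatOn lab pr ρ σ (renameFO r φ) ⇔ SatOn lab pr (ρ ∘ r) σ φ
  SatOn-renameFO r ρ σ (letter a x) = ⇔.refl
  SatOn-renameFO r ρ σ (leq x y)    = ⇔.refl
  SatOn-renameFO r ρ σ (pred i x)   = ⇔.refl
  SatOn-renameFO r ρ σ (mem x X)    = ⇔.refl
  SatOn-renameFO r ρ σ (neg φ)      = ¬-cong-⇔ (SatOn-renameFO r ρ σ φ)
  SatOn-renameFO r ρ σ (and φ ψ)    = SatOn-renameFO r ρ σ φ ×-⇔ SatOn-renameFO r ρ σ ψ
  SatOn-renameFO r ρ σ (or φ ψ)     = SatOn-renameFO r ρ σ φ ⊎-⇔ SatOn-renameFO r ρ σ ψ
  SatOn-renameFO r ρ σ (ex1 φ)      = Σ-cong-⇔ λ p → ⇔.trans (SatOn-renameFO (Fin.lift 1 r) (ext p ρ) σ φ)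
    (SatOn-cong (λ _ → refl) (λ _ _ → refl) (λ { zero → refl ; (suc _) → refl }) (λ _ _ → refl) φ)
  SatOn-renameFO r ρ σ (all1 φ)     = Π-cong-⇔ λ p → ⇔.trans (SatOn-renameFO (Fin.lift 1 r) (ext p ρ) σ φ)
    (SatOn-cong (λ _ → refl) (λ _ _ → refl) (λ { zero → refl ; (suc _) → refl }) (λ _ _ → refl) φ)
  SatOn-renameFO r ρ σ (ex2 φ)      = Σ-cong-⇔ λ X → SatOn-renameFO r ρ (ext X σ) φ
  SatOn-renameFO r ρ σ (all2 φ)     = Π-cong-⇔ λ X → SatOn-renameFO r ρ (ext X σ) φ

  SatOn-resp-head : ∀ {f s} ρ σ (φ : Formula k ℓ f (suc s)) {X Y : Fin N → Bool} →
                    X ≗ Y → SatOn lab pr ρ (ext X σ) φ → SatOn lab pr ρ (ext Y σ) φ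
  SatOn-resp-head ρ σ φ X≗Y = to (SatOn-cong (λ _ → refl) (λ _ _ → refl) (λ _ → refl)
                                             (λ { zero → X≗Y ; (suc _) _ → refl }) φ)

  SatOn? : ∀ {f s} ρ σ (φ : Formula k ℓ f s) → Dec (SatOn lab pr ρ σ φ)
  SatOn? ρ σ (letter a x) = lab (ρ x) Fin.≟ a
  SatOn? ρ σ (leq x y)    = ρ x Fin.≤? ρ y
  SatOn? ρ σ (pred i x)   = pr i (ρ x) Bool.≟ true
  SatOn? ρ σ (mem x X)    = σ X (ρ x) Bool.≟ true
  SatOn? ρ σ (neg φ)      = ¬? (SatOn? ρ σ φ)
  SatOn? ρ σ (and φ ψ)    = SatOn? ρ σ φ ×-dec SatOn? ρ σ ψ
  SatOn? ρ σ (or φ ψ)     = SatOn? ρ σ φ ⊎-dec SatOn? ρ σ ψ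
  SatOn? ρ σ (ex1 φ)      = Fin.any? λ p → SatOn? (ext p ρ) σ φ
  SatOn? ρ σ (all1 φ)     = Fin.all? λ p → SatOn? (ext p ρ) σ φ
  SatOn? ρ σ (ex2 φ)      = ∃-set? (SatOn-resp-head ρ σ φ) λ X → SatOn? ρ (ext X σ) φ
  SatOn? ρ σ (all2 φ)     = ∀-set? (SatOn-resp-head ρ σ φ) λ X → SatOn? ρ (ext X σ) φ

top : ∀ {k ℓ f s} → Formula k ℓ f s
top = all1 (leq zero zero)

bot : ∀ {k ℓ f s} → Formula k ℓ f s
bot = neg top

bool : ∀ {k ℓ f s} → Bool → Formula k ℓ f s
bool true  = top
bool false = bot

imp : ∀ {k ℓ f s} → Formula k ℓ f s → Formula k ℓ f s → Formula k ℓ f s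
imp φ ψ = or (neg φ) ψ

iff : ∀ {k ℓ f s} → Formula k ℓ f s → Formula k ℓ f s → Formula k ℓ f s
iff φ ψ = and (imp φ ψ) (imp ψ φ)

when : ∀ {k ℓ f s} {P : Set} → Dec P → Formula k ℓ f s → Formula k ℓ f s
when (yes _) φ = φ
when (no _)  φ = top

ands : ∀ {k ℓ f s} m → (Fin m → Formula k ℓ f s) → Formula k ℓ f s
ands zero    φs = top
ands (suc m) φs = and (φs zero) (ands m (φs ∘ suc))

ors : ∀ {k ℓ f s} m → (Fin m → Formula k ℓ f s) → Formula k ℓ f s
ors zero    φs = bot
ors (suc m) φs = or (φs zero) (ors m (φs ∘ suc))

exs2 : ∀ {k ℓ f s} r → Formula k ℓ f (r + s) → Formula k ℓ f s
exs2 zero    φ = φ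
exs2 (suc r) φ = exs2 r (ex2 φ)

alls2 : ∀ {k ℓ f s} r → Formula k ℓ f (r + s) → Formula k ℓ f s
alls2 zero    φ = φ
alls2 (suc r) φ = alls2 r (all2 φ)

lessF : ∀ {k ℓ f s} → Fin f → Fin f → Formula k ℓ f s
lessF x y = and (leq x y) (neg (leq y x))

succF : ∀ {k ℓ f s} → Fin f → Fin f → Formula k ℓ f s
succF x y = and (lessF x y) (all1 (or (leq zero (suc x)) (leq (suc y) zero)))

firstF : ∀ {k ℓ f s} → Formula k ℓ (suc f) s
firstF = all1 (leq (suc zero) zero)

lastF : ∀ {k ℓ f s} → Formula k ℓ (suc f) s
lastF = all1 (leq zero (suc zero))

nothing-between⇔succ : ∀ {N} {x y : Fin N} →
                       (x Fin.< y × (∀ z → z Fin.≤ x ⊎ y Fin.≤ z)) ⇔ (toℕ y ≡ suc (toℕ x))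
nothing-between⇔succ {N} {x} {y} = mk⇔ to′ from′
  where
    to′ : x Fin.< y × (∀ z → z Fin.≤ x ⊎ y Fin.≤ z) → toℕ y ≡ suc (toℕ x)
    to′ (x<y , gap) with ℕ.m≤n⇒m<n∨m≡n x<y
    ... | inj₂ y≡1+x = sym y≡1+x
    ... | inj₁ 1+x<y with gap (fromℕ< (ℕ.<-trans 1+x<y (Fin.toℕ<n y)))
    ...   | inj₁ z≤x = ⊥-elim (ℕ.n≮n _ (subst (ℕ._≤ toℕ x) (Fin.toℕ-fromℕ< _) z≤x))
    ...   | inj₂ y≤z = ⊥-elim (ℕ.<⇒≱ 1+x<y (subst (toℕ y ℕ.≤_) (Fin.toℕ-fromℕ< _) y≤z))
    from′ : toℕ y ≡ suc (toℕ x) → x Fin.< y × (∀ z → z Fin.≤ x ⊎ y Fin.≤ z)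
    from′ y≡1+x = ℕ.≤-reflexive (sym y≡1+x) , between
      where
        between : ∀ z → z Fin.≤ x ⊎ y Fin.≤ z
        between z with z Fin.≤? x
        ... | yes z≤x = inj₁ z≤x
        ... | no  z≰x = inj₂ (subst (ℕ._≤ toℕ z) (sym y≡1+x) (ℕ.≰⇒> z≰x))

module Connectives {k ℓ N : ℕ} (lab : Fin N → Fin k) (pr : Fin ℓ → Fin N → Bool) where

  sat-top : ∀ {f s} ρ σ → SatOn lab pr {f} {s} ρ σ top
  sat-top ρ σ p = Fin.≤-refl

  sat-bot : ∀ {f s} ρ σ → ¬ SatOn lab pr {f} {s} ρ σ bot
  sat-bot ρ σ ¬⊤ = ¬⊤ (sat-top ρ σ)

  sat-bool : ∀ {f s} ρ σ b → SatOn lab pr {f} {s} ρ σ (bool b) ⇔ (b ≡ true)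
  sat-bool ρ σ true  = mk⇔ (λ _ → refl) (λ _ → sat-top ρ σ)
  sat-bool ρ σ false = mk⇔ (⊥-elim ∘ sat-bot ρ σ) (λ ())

  sat-imp : ∀ {f s} ρ σ (φ ψ : Formula k ℓ f s) →
            SatOn lab pr ρ σ (imp φ ψ) ⇔ (SatOn lab pr ρ σ φ → SatOn lab pr ρ σ ψ)
  sat-imp ρ σ φ ψ = mk⇔ (λ { (inj₁ ¬a) a → ⊥-elim (¬a a) ; (inj₂ b) _ → b }) from′
    where
      from′ : (SatOn lab pr ρ σ φ → SatOn lab pr ρ σ ψ) → SatOn lab pr ρ σ (imp φ ψ)
      from′ h with SatOn? lab pr ρ σ φ
      ... | yes a = inj₂ (h a)
      ... | no ¬a = inj₁ ¬a

  sat-iff : ∀ {f s} ρ σ (φ ψ : Formula k ℓ f s) →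
            SatOn lab pr ρ σ (iff φ ψ) ⇔ (SatOn lab pr ρ σ φ ⇔ SatOn lab pr ρ σ ψ)
  sat-iff ρ σ φ ψ = ⇔.trans (sat-imp ρ σ φ ψ ×-⇔ sat-imp ρ σ ψ φ)
                            (mk⇔ (λ (f , g) → mk⇔ f g) (λ e → to e , from e))

  sat-when : ∀ {f s} ρ σ {P : Set} (P? : Dec P) (φ : Formula k ℓ f s) →
             SatOn lab pr ρ σ (when P? φ) ⇔ (P → SatOn lab pr ρ σ φ)
  sat-when ρ σ (yes p) φ = mk⇔ (λ a _ → a) (λ h → h p)
  sat-when ρ σ (no ¬p) φ = mk⇔ (λ _ p → ⊥-elim (¬p p)) (λ _ → sat-top ρ σ)

  sat-ands : ∀ {f s} ρ σ m (φs : Fin m → Formula k ℓ f s) →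
             SatOn lab pr ρ σ (ands m φs) ⇔ (∀ j → SatOn lab pr ρ σ (φs j))
  sat-ands ρ σ zero    φs = mk⇔ (λ _ ()) (λ _ → sat-top ρ σ)
  sat-ands ρ σ (suc m) φs = mk⇔ (λ { (a , b) zero → a ; (a , b) (suc j) → to (sat-ands ρ σ m _) b j })
                                (λ h → h zero , from (sat-ands ρ σ m _) (h ∘ suc))

  sat-ors : ∀ {f s} ρ σ m (φs : Fin m → Formula k ℓ f s) →
            SatOn lab pr ρ σ (ors m φs) ⇔ (∃[ j ] SatOn lab pr ρ σ (φs j))
  sat-ors ρ σ zero    φs = mk⇔ (⊥-elim ∘ sat-bot ρ σ) (λ ())
  sat-ors ρ σ (suc m) φs =
    mk⇔ (λ { (inj₁ a) → zero , a ; (inj₂ b) → let (j , c) = to (sat-ors ρ σ m _) b in suc j , c })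
        (λ { (zero , a) → inj₁ a ; (suc j , c) → inj₂ (from (sat-ors ρ σ m _) (j , c)) })

  private
    SatOn-ext-++ : ∀ {f r s} ρ σ (φ : Formula k ℓ f (suc r + s)) (Xs : Fin (suc r) → Fin N → Bool) →
                   SatOn lab pr ρ (ext (Xs zero) (Xs ∘ suc ++ σ)) φ ⇔ SatOn lab pr ρ (Xs ++ σ) φ
    SatOn-ext-++ ρ σ φ Xs =
      SatOn-cong (λ _ → refl) (λ _ _ → refl) (λ _ → refl) (λ i → cong-app (ext-++ Xs σ i)) φ

  sat-exs2 : ∀ {f s} ρ σ r (φ : Formula k ℓ f (r + s)) →
             SatOn lab pr ρ σ (exs2 r φ) ⇔ (∃[ Xs ] SatOn lab pr ρ (Xs ++ σ) φ)
  sat-exs2 ρ σ zero    φ = mk⇔ (λ h → (λ ()) , h) proj₂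
  sat-exs2 ρ σ (suc r) φ = ⇔.trans (sat-exs2 ρ σ r (ex2 φ))
    (mk⇔ (λ (Ys , X , h) → ext X Ys , to (SatOn-ext-++ ρ σ φ (ext X Ys)) h)
         (λ (Xs , h) → Xs ∘ suc , Xs zero , from (SatOn-ext-++ ρ σ φ Xs) h))

  sat-alls2 : ∀ {f s} ρ σ r (φ : Formula k ℓ f (r + s)) →
              SatOn lab pr ρ σ (alls2 r φ) ⇔ (∀ Xs → SatOn lab pr ρ (Xs ++ σ) φ)
  sat-alls2 ρ σ zero    φ = mk⇔ (λ h Xs → h) (λ h → h (λ ()))
  sat-alls2 ρ σ (suc r) φ = ⇔.trans (sat-alls2 ρ σ r (all2 φ))
    (mk⇔ (λ h Xs → to (SatOn-ext-++ ρ σ φ Xs) (h (Xs ∘ suc) (Xs zero)))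
         (λ h Ys X → from (SatOn-ext-++ ρ σ φ (ext X Ys)) (h (ext X Ys))))

  sat-lessF : ∀ {f s} ρ σ (x y : Fin f) → SatOn lab pr {f} {s} ρ σ (lessF x y) ⇔ ρ x Fin.< ρ y
  sat-lessF ρ σ x y = mk⇔ (λ (_ , y≰x) → ℕ.≰⇒> y≰x) (λ x<y → ℕ.<⇒≤ x<y , ℕ.<⇒≱ x<y)

  sat-succF : ∀ {f s} ρ σ (x y : Fin f) →
              SatOn lab pr {f} {s} ρ σ (succF x y) ⇔ (toℕ (ρ y) ≡ suc (toℕ (ρ x)))
  sat-succF ρ σ x y = ⇔.trans (sat-lessF ρ σ x y ×-⇔ ⇔.refl) nothing-between⇔succ

blank : ∀ {N} → Fin N → Fin 1
blank _ = zero

noPredicates : ∀ {N} → Fin 0 → Fin N → Bool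
noPredicates ()

Sat₁ : ∀ {f s} N → (Fin f → Fin N) → (Fin s → Fin N → Bool) → Formula 1 0 f s → Set
Sat₁ N = SatOn {N = N} blank noPredicates

open module Connectives₁ {N : ℕ} = Connectives {N = N} blank noPredicates

sat-iff-mem : ∀ {f s N} ρ σ (x : Fin f) (X Y : Fin s) →
              Sat₁ N ρ σ (iff (mem x X) (mem x Y)) ⇔ (σ X (ρ x) ≡ σ Y (ρ x))
sat-iff-mem ρ σ x X Y = ⇔.trans (sat-iff ρ σ (mem x X) (mem x Y))
                                (mk⇔ ≡-true-injective ≡-congˡ-⇔)

-- Letters and predicate symbols as set variables

eraseSymbols : ∀ {k ℓ f s t} → (Fin k → Fin t) → (Fin ℓ → Fin t) → Formula k ℓ f s → Formula 1 0 f (s + t)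
eraseSymbols {s = s} lv pv (letter a x) = mem x (s ↑ʳ lv a)
eraseSymbols         lv pv (leq x y)    = leq x y
eraseSymbols {s = s} lv pv (pred i x)   = mem x (s ↑ʳ pv i)
eraseSymbols {t = t} lv pv (mem x X)    = mem x (X ↑ˡ t)
eraseSymbols         lv pv (neg φ)      = neg (eraseSymbols lv pv φ)
eraseSymbols         lv pv (and φ ψ)    = and (eraseSymbols lv pv φ) (eraseSymbols lv pv ψ)
eraseSymbols         lv pv (or φ ψ)     = or (eraseSymbols lv pv φ) (eraseSymbols lv pv ψ)
eraseSymbols         lv pv (ex1 φ)      = ex1 (eraseSymbols lv pv φ)
eraseSymbols         lv pv (all1 φ)     = all1 (eraseSymbols lv pv φ)
eraseSymbols         lv pv (ex2 φ)      = ex2 (eraseSymbols lv pv φ)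
eraseSymbols         lv pv (all2 φ)     = all2 (eraseSymbols lv pv φ)

LetterSets : ∀ {k N} → (Fin N → Fin k) → (Fin k → Fin N → Bool) → Set
LetterSets lab U = ∀ a x → (lab x ≡ a) ⇔ (U a x ≡ true)

module _ {k ℓ N t : ℕ} {lab : Fin N → Fin k} {pr : Fin ℓ → Fin N → Bool} {τ : Fin t → Fin N → Bool}
         {lv : Fin k → Fin t} {pv : Fin ℓ → Fin t}
         (letters : LetterSets lab (τ ∘ lv)) (predicates : pr ≗₂ (τ ∘ pv)) where

  private
    Sat₁-ext-++ : ∀ {f s} ρ σ X (ψ : Formula 1 0 f (suc s + t)) →
                  Sat₁ N ρ (ext X σ ++ τ) ψ ⇔ Sat₁ N ρ (ext X (σ ++ τ)) ψ
    Sat₁-ext-++ ρ σ X ψ =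
      SatOn-cong (λ _ → refl) (λ ()) (λ _ → refl) (λ i → cong-app (sym (ext-++ (ext X σ) τ i))) ψ

  sat-eraseSymbols : ∀ {f s} ρ σ (φ : Formula k ℓ f s) →
                     SatOn lab pr ρ σ φ ⇔ Sat₁ N ρ (σ ++ τ) (eraseSymbols lv pv φ)
  sat-eraseSymbols ρ σ (letter a x) =
    ⇔.trans (letters a (ρ x)) (≡-congˡ-⇔ (sym (cong-app (lookup-++ʳ σ τ (lv a)) (ρ x))))
  sat-eraseSymbols ρ σ (leq x y)  = ⇔.refl
  sat-eraseSymbols ρ σ (pred i x) =
    ≡-congˡ-⇔ (trans (predicates i (ρ x)) (sym (cong-app (lookup-++ʳ σ τ (pv i)) (ρ x))))
  sat-eraseSymbols ρ σ (mem x X)  = ≡-congˡ-⇔ (sym (cong-app (lookup-++ˡ σ τ X) (ρ x)))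
  sat-eraseSymbols ρ σ (neg φ)    = ¬-cong-⇔ (sat-eraseSymbols ρ σ φ)
  sat-eraseSymbols ρ σ (and φ ψ)  = sat-eraseSymbols ρ σ φ ×-⇔ sat-eraseSymbols ρ σ ψ
  sat-eraseSymbols ρ σ (or φ ψ)   = sat-eraseSymbols ρ σ φ ⊎-⇔ sat-eraseSymbols ρ σ ψ
  sat-eraseSymbols ρ σ (ex1 φ)    = Σ-cong-⇔ λ p → sat-eraseSymbols (ext p ρ) σ φ
  sat-eraseSymbols ρ σ (all1 φ)   = Π-cong-⇔ λ p → sat-eraseSymbols (ext p ρ) σ φ
  sat-eraseSymbols ρ σ (ex2 φ)    = Σ-cong-⇔ λ X →
    ⇔.trans (sat-eraseSymbols ρ (ext X σ) φ) (Sat₁-ext-++ ρ σ X (eraseSymbols lv pv φ))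
  sat-eraseSymbols ρ σ (all2 φ)   = Π-cong-⇔ λ X →
    ⇔.trans (sat-eraseSymbols ρ (ext X σ) φ) (Sat₁-ext-++ ρ σ X (eraseSymbols lv pv φ))

LetterSets-resp : ∀ {k N} {lab : Fin N → Fin k} {U U′ : Fin k → Fin N → Bool} →
                  (∀ a → U a ≡ U′ a) → LetterSets lab U → LetterSets lab U′
LetterSets-resp U≡U′ sets a x = ⇔.trans (sets a x) (≡-congˡ-⇔ (cong-app (U≡U′ a) x))

IsPartition : ∀ {k N} → (Fin k → Fin N → Bool) → Set
IsPartition {k} {N} U = ∀ x → (∃[ a ] U a x ≡ true) × (∀ a b → a ≢ b → ¬ (U a x ≡ true × U b x ≡ true))

partitionF : ∀ {k s} → (Fin k → Fin s) → Formula 1 0 0 s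
partitionF {k} U = all1 (and (ors k λ a → mem zero (U a))
                             (ands k λ a → ands k λ b →
                               when (¬? (a Fin.≟ b)) (neg (and (mem zero (U a)) (mem zero (U b))))))

sat-partitionF : ∀ {k s} N (U : Fin k → Fin s) σ → Sat₁ N emptyVal σ (partitionF U) ⇔ IsPartition (σ ∘ U)
sat-partitionF {k} N U σ = Π-cong-⇔ λ x →
  sat-ors (ext x emptyVal) σ k _ ×-⇔
  ⇔.trans (sat-ands (ext x emptyVal) σ k _) (Π-cong-⇔ λ a →
  ⇔.trans (sat-ands (ext x emptyVal) σ k _) (Π-cong-⇔ λ b →
  sat-when (ext x emptyVal) σ (¬? (a Fin.≟ b)) _))

LetterSets⇒IsPartition : ∀ {k N} {lab : Fin N → Fin k} {U} → LetterSets lab U → IsPartition U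
LetterSets⇒IsPartition {lab = lab} sets x =
  (lab x , to (sets (lab x) x) refl) ,
  λ a b a≢b (a∈ , b∈) → a≢b (trans (sym (from (sets a x) a∈)) (from (sets b x) b∈))

IsPartition⇒LetterSets : ∀ {k N} {U : Fin k → Fin N → Bool} → IsPartition U → ∃[ lab ] LetterSets lab U
IsPartition⇒LetterSets {U = U} part = lab , λ a x → mk⇔ (λ { refl → proj₂ (proj₁ (part x)) }) (unique a x)
  where
    lab = λ x → proj₁ (proj₁ (part x))
    unique : ∀ a x → U a x ≡ true → lab x ≡ a
    unique a x a∈ with lab x Fin.≟ a
    ... | yes eq  = eq
    ... | no  lab≢a = ⊥-elim (proj₂ (part x) _ _ lab≢a (proj₂ (proj₁ (part x)) , a∈))

indicator : ∀ {k N} → (Fin N → Fin k) → Fin k → Fin N → Bool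
indicator lab a x = Dec.isYes (lab x Fin.≟ a)

LetterSets-indicator : ∀ {k N} (lab : Fin N → Fin k) → LetterSets lab (indicator lab)
LetterSets-indicator lab a x = ⇔.sym (isYes≡true⇔ (lab x Fin.≟ a))

-- Regular languages are MSO-definable

module Automaton {k : ℕ} (D : DFA k) where

  open DFA D

  stateAfter : ∀ {N} → Fin states → (Fin N → Fin k) → Fin N → Fin states
  stateAfter q lab zero    = δ q (lab zero)
  stateAfter q lab (suc p) = stateAfter (δ q (lab zero)) (lab ∘ suc) p

  run-tabulate : ∀ N q (lab : Fin (suc N) → Fin k) → run D q (tabulate lab) ≡ stateAfter q lab (fromℕ N)
  run-tabulate zero    q lab = refl
  run-tabulate (suc N) q lab = run-tabulate N (δ q (lab zero)) (lab ∘ suc)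

  stateAfter-succ : ∀ {N} q (lab : Fin N → Fin k) x y → toℕ y ≡ suc (toℕ x) →
                    stateAfter q lab y ≡ δ (stateAfter q lab x) (lab y)
  stateAfter-succ q lab zero    (suc zero) _   = refl
  stateAfter-succ q lab (suc x) (suc y)    y≡1+x =
    stateAfter-succ (δ q (lab zero)) (lab ∘ suc) x y (ℕ.suc-injective y≡1+x)

  -- Ss q x ≡ true reads "the automaton may be in state q after position x"
  CoversFirst : ∀ {N} → (Fin N → Fin k) → (Fin states → Fin N → Bool) → Set
  CoversFirst {N} lab Ss = ∀ x → (∀ (y : Fin N) → x Fin.≤ y) → Ss (δ start (lab x)) x ≡ true

  CoversStep : ∀ {N} → (Fin N → Fin k) → (Fin states → Fin N → Bool) → Set
  CoversStep lab Ss = ∀ x y → toℕ y ≡ suc (toℕ x) → ∀ q → Ss q x ≡ true → Ss (δ q (lab y)) y ≡ true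

  CoversRun : ∀ {N} → (Fin N → Fin k) → (Fin states → Fin N → Bool) → Set
  CoversRun lab Ss = CoversFirst lab Ss × CoversStep lab Ss

  FinalAtEnd : ∀ {N} → (Fin states → Fin N → Bool) → Set
  FinalAtEnd {N} Ss = ∃[ x ] (∀ (y : Fin N) → y Fin.≤ x) × (∀ q → Ss q x ≡ true → final q ≡ true)

  Accepting : ∀ N → (Fin N → Fin k) → Set
  Accepting N lab = (¬ Fin N × final start ≡ true) ⊎ (∃[ Ss ] CoversRun lab Ss × FinalAtEnd Ss)

  module _ {N : ℕ} (lab : Fin (suc N) → Fin k) where

    CoversRun⇒stateAfter∈ : ∀ {Ss} → CoversRun lab Ss → ∀ p → Ss (stateAfter start lab p) p ≡ true
    CoversRun⇒stateAfter∈ {Ss} (first , step) = <-weakInduction (λ p → Ss (stateAfter start lab p) p ≡ true)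
      (first zero (λ _ → z≤n))
      (λ i i∈ → subst (λ q → Ss q (suc i) ≡ true)
                      (sym (stateAfter-succ start lab (Fin.inject₁ i) (suc i) (1+inject₁ i)))
                      (step (Fin.inject₁ i) (suc i) (1+inject₁ i) _ i∈))
      where
        1+inject₁ : ∀ i → toℕ (suc i) ≡ suc (toℕ (Fin.inject₁ i))
        1+inject₁ i = cong suc (sym (Fin.toℕ-inject₁ i))

    exactRun : Fin states → Fin (suc N) → Bool
    exactRun q p = Dec.isYes (q Fin.≟ stateAfter start lab p)

    exactRun⇔ : ∀ q p → (exactRun q p ≡ true) ⇔ (q ≡ stateAfter start lab p)
    exactRun⇔ q p = isYes≡true⇔ (q Fin.≟ stateAfter start lab p)

    CoversRun-exactRun : CoversRun lab exactRun
    CoversRun-exactRun = first , step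
      where
        first : ∀ x → (∀ (y : Fin (suc N)) → x Fin.≤ y) → exactRun (δ start (lab x)) x ≡ true
        first zero    _      = from (exactRun⇔ _ zero) refl
        first (suc x) x≤zero with () ← x≤zero zero
        step : ∀ x y → toℕ y ≡ suc (toℕ x) → ∀ q → exactRun q x ≡ true → exactRun (δ q (lab y)) y ≡ true
        step x y y≡1+x q q∈ = from (exactRun⇔ _ y)
          (trans (cong (λ q → δ q (lab y)) (to (exactRun⇔ q x) q∈))
                 (sym (stateAfter-succ start lab x y y≡1+x)))

    last≡fromℕ : ∀ x → (∀ (y : Fin (suc N)) → y Fin.≤ x) → x ≡ fromℕ N
    last≡fromℕ x x-last = Fin.≤-antisym (Fin.≤fromℕ x) (x-last (fromℕ N))

  Accepting⇔accepts : ∀ N (lab : Fin N → Fin k) → Accepting N lab ⇔ accepts D (tabulate lab)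
  Accepting⇔accepts zero    lab = mk⇔ (λ { (inj₁ (_ , final-start)) → final-start ; (inj₂ (_ , _ , () , _)) })
                                      (λ final-start → inj₁ ((λ ()) , final-start))
  Accepting⇔accepts (suc N) lab = mk⇔ to′ from′
    where
      to′ : Accepting (suc N) lab → accepts D (tabulate lab)
      to′ (inj₁ (¬Fin , _)) = ⊥-elim (¬Fin zero)
      to′ (inj₂ (Ss , covers , x , x-last , finalAt)) =
        subst (λ q → final q ≡ true) (sym (run-tabulate N start lab))
          (subst (λ x → final (stateAfter start lab x) ≡ true) (last≡fromℕ lab x x-last)
            (finalAt _ (CoversRun⇒stateAfter∈ lab covers x)))
      from′ : accepts D (tabulate lab) → Accepting (suc N) lab
      from′ accepted = inj₂ (exactRun lab , CoversRun-exactRun lab , fromℕ N , Fin.≤fromℕ , λ q q∈ →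
        subst (λ q → final q ≡ true)
              (sym (trans (to (exactRun⇔ lab q (fromℕ N)) q∈) (sym (run-tabulate N start lab)))) accepted)

  module _ {s : ℕ} (U : Fin k → Fin s) where

    private
      S : Fin states → Fin (states + s)
      S q = q ↑ˡ s

      L : Fin k → Fin (states + s)
      L a = states ↑ʳ U a

    readsInto : ∀ {f} → (Fin k → Fin states) → Formula 1 0 (suc f) (states + s)
    readsInto t = ands k λ a → imp (mem zero (L a)) (mem zero (S (t a)))

    stepFrom : Fin states → Formula 1 0 2 (states + s)
    stepFrom q = imp (mem (suc zero) (S q)) (readsInto (δ q))

    finalIfIn : Fin states → Formula 1 0 1 (states + s)
    finalIfIn q = imp (mem zero (S q)) (bool (final q))

    coversFirstF : Formula 1 0 0 (states + s)
    coversFirstF = all1 (imp firstF (readsInto (δ start)))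

    coversStepF : Formula 1 0 0 (states + s)
    coversStepF = all1 (all1 (imp (succF (suc zero) zero) (ands states stepFrom)))

    finalAtEndF : Formula 1 0 0 (states + s)
    finalAtEndF = ex1 (and lastF (ands states finalIfIn))

    acceptF : Formula 1 0 0 s
    acceptF = or (and (neg (ex1 top)) (bool (final start)))
                 (exs2 states (and (and coversFirstF coversStepF) finalAtEndF))

    module _ {N : ℕ} (σ : Fin s → Fin N → Bool) {lab : Fin N → Fin k}
             (letters : LetterSets lab (σ ∘ U)) where

      private
        in-S : ∀ Ss q x → ((Ss ++ σ) (S q) x ≡ true) ⇔ (Ss q x ≡ true)
        in-S Ss q x = ≡-congˡ-⇔ (cong-app (lookup-++ˡ Ss σ q) x)

        in-L : ∀ Ss a x → ((Ss ++ σ) (L a) x ≡ true) ⇔ (lab x ≡ a)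
        in-L Ss a x = ⇔.trans (≡-congˡ-⇔ (cong-app (lookup-++ʳ Ss σ (U a)) x)) (⇔.sym (letters a x))

      sat-readsInto : ∀ {f} Ss ρ (t : Fin k → Fin states) →
                      Sat₁ {suc f} N ρ (Ss ++ σ) (readsInto t) ⇔ (Ss (t (lab (ρ zero))) (ρ zero) ≡ true)
      sat-readsInto Ss ρ t =
        ⇔.trans (sat-ands ρ (Ss ++ σ) k _)
        (⇔.trans (Π-cong-⇔ λ a → ⇔.trans (sat-imp ρ (Ss ++ σ) (mem zero (L a)) (mem zero (S (t a))))
                                          (→-cong-⇔ (in-L Ss a (ρ zero)) (in-S Ss (t a) (ρ zero))))
                 (∀-≡-elim (lab (ρ zero))))

      sat-coversFirstF : ∀ Ss → Sat₁ N emptyVal (Ss ++ σ) coversFirstF ⇔ CoversFirst lab Ss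
      sat-coversFirstF Ss = Π-cong-⇔ λ x →
        ⇔.trans (sat-imp (ext x emptyVal) (Ss ++ σ) firstF (readsInto (δ start)))
                (→-cong-⇔ ⇔.refl (sat-readsInto Ss (ext x emptyVal) (δ start)))

      sat-coversStepF : ∀ Ss → Sat₁ N emptyVal (Ss ++ σ) coversStepF ⇔ CoversStep lab Ss
      sat-coversStepF Ss = Π-cong-⇔ λ x → Π-cong-⇔ λ y →
        let ρ = ext y (ext x emptyVal) in
        ⇔.trans (sat-imp ρ (Ss ++ σ) (succF (suc zero) zero) (ands states stepFrom))
          (→-cong-⇔ (sat-succF ρ (Ss ++ σ) (suc zero) zero)
            (⇔.trans (sat-ands ρ (Ss ++ σ) states stepFrom) (Π-cong-⇔ λ q →
              ⇔.trans (sat-imp ρ (Ss ++ σ) (mem (suc zero) (S q)) (readsInto (δ q)))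
                      (→-cong-⇔ (in-S Ss q x) (sat-readsInto Ss ρ (δ q))))))

      sat-finalAtEndF : ∀ Ss → Sat₁ N emptyVal (Ss ++ σ) finalAtEndF ⇔ FinalAtEnd Ss
      sat-finalAtEndF Ss = Σ-cong-⇔ λ x →
        let ρ = ext x emptyVal in
        ⇔.refl ×-⇔ ⇔.trans (sat-ands ρ (Ss ++ σ) states finalIfIn) (Π-cong-⇔ λ q →
          ⇔.trans (sat-imp ρ (Ss ++ σ) (mem zero (S q)) (bool (final q)))
                  (→-cong-⇔ (in-S Ss q x) (sat-bool ρ (Ss ++ σ) (final q))))

      sat-acceptF : Sat₁ N emptyVal σ acceptF ⇔ accepts D (tabulate lab)
      sat-acceptF = ⇔.trans
        ((¬-cong-⇔ (mk⇔ proj₁ (λ p → p , sat-top (ext p emptyVal) σ)) ×-⇔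
          sat-bool emptyVal σ (final start)) ⊎-⇔
         ⇔.trans (sat-exs2 emptyVal σ states _) (Σ-cong-⇔ λ Ss →
           (sat-coversFirstF Ss ×-⇔ sat-coversStepF Ss) ×-⇔ sat-finalAtEndF Ss))
        (Accepting⇔accepts N lab)

-- A definable well-order on tuples of sets

module _ {A : Set} {_≈_ _≺_ : A → A → Set} where

  Lex-<-tabulate⇔ : ∀ {n} (f g : Fin n → A) →
                    Lex-< _≈_ _≺_ (Vec.tabulate f) (Vec.tabulate g) ⇔
                    (∃[ p ] (∀ q → q Fin.< p → f q ≈ g q) × f p ≺ g p)
  Lex-<-tabulate⇔ {zero}  f g = mk⇔ (λ { (base ()) }) (λ { (() , _) })
  Lex-<-tabulate⇔ {suc n} f g = mk⇔ to′ from′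
    where
      to′ : Lex-< _≈_ _≺_ (Vec.tabulate f) (Vec.tabulate g) →
            ∃[ p ] (∀ q → q Fin.< p → f q ≈ g q) × f p ≺ g p
      to′ (this f₀≺g₀ _)    = zero , (λ _ ()) , f₀≺g₀
      to′ (next f₀≈g₀ rest) with to (Lex-<-tabulate⇔ (f ∘ suc) (g ∘ suc)) rest
      ... | p , agree , fp≺gp = suc p , (λ { zero _ → f₀≈g₀ ; (suc q) (s≤s q<p) → agree q q<p }) , fp≺gp
      from′ : ∃[ p ] (∀ q → q Fin.< p → f q ≈ g q) × f p ≺ g p →
              Lex-< _≈_ _≺_ (Vec.tabulate f) (Vec.tabulate g)
      from′ (zero  , agree , f₀≺g₀) = this f₀≺g₀ refl
      from′ (suc p , agree , fp≺gp) = next (agree zero (s≤s z≤n))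
        (from (Lex-<-tabulate⇔ (f ∘ suc) (g ∘ suc)) (p , (λ q → agree (suc q) ∘ s≤s) , fp≺gp))

column : ∀ {ℓ N} → (Fin ℓ → Fin N → Bool) → Fin N → Vec.Vec Bool ℓ
column X p = Vec.tabulate λ i → X i p

infix 4 _≺_
_≺_ : ∀ {ℓ N} → (Fin ℓ → Fin N → Bool) → (Fin ℓ → Fin N → Bool) → Set
X ≺ Y = Lex-< (Pointwise _≡_) (Lex-< _≡_ _<ᴮ_) (Vec.tabulate (column X)) (Vec.tabulate (column Y))

≺-wellFounded : ∀ {ℓ N} → WellFounded (_≺_ {ℓ} {N})
≺-wellFounded = On.wellFounded (Vec.tabulate ∘ column)
  (Lex.<-wellFounded (Pointwise.trans trans)
                     (λ c≋d → subst (Lex-< _≡_ _<ᴮ_ _) (Pointwise.Pointwise-≡⇒≡ c≋d))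
                     (Lex.<-wellFounded trans (λ { refl b<c → b<c }) Bool.<-wellFounded))

≺-compare : ∀ {ℓ N} (X Y : Fin ℓ → Fin N → Bool) → X ≗₂ Y ⊎ X ≺ Y ⊎ Y ≺ X
≺-compare X Y with Lex.<-cmp (Pointwise.sym sym) (Lex.<-cmp sym Bool.<-cmp)
                             (Vec.tabulate (column X)) (Vec.tabulate (column Y))
... | tri< X≺Y _ _ = inj₂ (inj₁ X≺Y)
... | tri≈ _ X≋Y _ = inj₁ λ i p → Pointwise.tabulate⁻ (Pointwise.tabulate⁻ X≋Y p) i
... | tri> _ _ Y≺X = inj₂ (inj₂ Y≺X)

<ᴮ⇔ : ∀ {b c} → b <ᴮ c ⇔ (¬ b ≡ true × c ≡ true)
<ᴮ⇔ = mk⇔ (λ { f<t → (λ ()) , refl }) from′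
  where
    from′ : ∀ {b c} → ¬ b ≡ true × c ≡ true → b <ᴮ c
    from′ {false} (_ , refl) = f<t
    from′ {true}  (b≢true , _) = ⊥-elim (b≢true refl)

≺-resp : ∀ {ℓ N} {X X′ Y Y′ : Fin ℓ → Fin N → Bool} → X ≗₂ X′ → Y ≗₂ Y′ → X ≺ Y → X′ ≺ Y′
≺-resp X≗X′ Y≗Y′ = subst₂ (Lex-< _ _) (grid-cong X≗X′) (grid-cong Y≗Y′)
  where
    grid-cong : ∀ {X X′} → X ≗₂ X′ → Vec.tabulate (column X) ≡ Vec.tabulate (column X′)
    grid-cong X≗X′ = Vec.tabulate-cong λ p → Vec.tabulate-cong λ i → X≗X′ i p

module _ {ℓ s : ℕ} (ys xs : Fin ℓ → Fin s) where

  agreeAt : ∀ {f} → Fin f → Formula 1 0 f s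
  agreeAt x = ands ℓ λ j → iff (mem x (ys j)) (mem x (xs j))

  agreeBelow : Fin ℓ → Formula 1 0 1 s
  agreeBelow i = ands ℓ λ j → when (j Fin.<? i) (iff (mem zero (ys j)) (mem zero (xs j)))

  smallerAt : Formula 1 0 1 s
  smallerAt = ors ℓ λ i → and (agreeBelow i) (and (neg (mem zero (ys i))) (mem zero (xs i)))

  precedesF : Formula 1 0 0 s
  precedesF = ex1 (and (all1 (imp (lessF zero (suc zero)) (agreeAt zero))) smallerAt)

  module _ {N : ℕ} (σ : Fin s → Fin N → Bool) where

    private
      Y = σ ∘ ys
      X = σ ∘ xs

    sat-agreeAt : ∀ {f} ρ (x : Fin f) →
                  Sat₁ N ρ σ (agreeAt x) ⇔ Pointwise _≡_ (column Y (ρ x)) (column X (ρ x))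
    sat-agreeAt ρ x = ⇔.trans (sat-ands ρ σ ℓ _)
      (⇔.trans (Π-cong-⇔ λ j → sat-iff-mem ρ σ x (ys j) (xs j)) (mk⇔ Pointwise.tabulate⁺ Pointwise.tabulate⁻))

    sat-smallerAt : ∀ p → Sat₁ N (ext p emptyVal) σ smallerAt ⇔ Lex-< _≡_ _<ᴮ_ (column Y p) (column X p)
    sat-smallerAt p = ⇔.trans (sat-ors ρ σ ℓ _)
      (⇔.trans (Σ-cong-⇔ λ i → below i ×-⇔ ⇔.sym <ᴮ⇔) (⇔.sym (Lex-<-tabulate⇔ _ _)))
      where
        ρ = ext p emptyVal
        below : ∀ i → Sat₁ N ρ σ (agreeBelow i) ⇔ (∀ j → j Fin.< i → Y j p ≡ X j p)
        below i = ⇔.trans (sat-ands ρ σ ℓ _) (Π-cong-⇔ λ j →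
          ⇔.trans (sat-when ρ σ (j Fin.<? i) (iff (mem zero (ys j)) (mem zero (xs j))))
                  (→-cong-⇔ ⇔.refl (sat-iff-mem ρ σ zero (ys j) (xs j))))

    sat-precedesF : Sat₁ N emptyVal σ precedesF ⇔ Y ≺ X
    sat-precedesF = ⇔.trans (Σ-cong-⇔ λ p → agreeBefore p ×-⇔ sat-smallerAt p) (⇔.sym (Lex-<-tabulate⇔ _ _))
      where
        agreeBefore : ∀ p → Sat₁ N (ext p emptyVal) σ (all1 (imp (lessF zero (suc zero)) (agreeAt zero))) ⇔
                            (∀ q → q Fin.< p → Pointwise _≡_ (column Y q) (column X q))
        agreeBefore p = Π-cong-⇔ λ q →
          let ρ = ext q (ext p emptyVal) in
          ⇔.trans (sat-imp ρ σ (lessF zero (suc zero)) (agreeAt zero))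
                  (→-cong-⇔ (sat-lessF ρ σ zero (suc zero)) (sat-agreeAt ρ zero))

-- The least good interpretation of the predicate symbols

module Minimisation {k ℓ : ℕ} (φ : Sentence k ℓ) (D : DFA k) where

  open Automaton D using (acceptF; sat-acceptF)

  Good : ∀ N → (Fin ℓ → Fin N → Bool) → Set
  Good N X = ∀ (lab : Fin N → Fin k) → SatOn lab X emptyVal emptyVal φ ⇔ accepts D (tabulate lab)

  Good-resp : ∀ {N} {X X′ : Fin ℓ → Fin N → Bool} → X ≗₂ X′ → Good N X → Good N X′
  Good-resp X≗X′ good lab =
    ⇔.trans (SatOn-cong (λ _ → refl) (λ i → sym ∘ X≗X′ i) (λ ()) (λ ()) φ) (good lab)

  goodF : ∀ {s} → (Fin ℓ → Fin s) → Formula 1 0 0 s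
  goodF {s} xs = alls2 k (imp (partitionF (_↑ˡ s))
                              (iff (eraseSymbols (_↑ˡ s) ((k ↑ʳ_) ∘ xs) φ) (acceptF (_↑ˡ s))))

  sat-goodF : ∀ {s N} (σ : Fin s → Fin N → Bool) xs → Sat₁ N emptyVal σ (goodF xs) ⇔ Good N (σ ∘ xs)
  sat-goodF {s} {N} σ xs = ⇔.trans (sat-alls2 emptyVal σ k body) (mk⇔ to′ from′)
    where
      E = eraseSymbols (_↑ˡ s) ((k ↑ʳ_) ∘ xs) φ
      A = acceptF (_↑ˡ s)
      body = imp (partitionF (_↑ˡ s)) (iff E A)

      body⇔ : ∀ Us → Sat₁ N emptyVal (Us ++ σ) body ⇔
                     (IsPartition ((Us ++ σ) ∘ (_↑ˡ s)) →
                      (Sat₁ N emptyVal (Us ++ σ) E ⇔ Sat₁ N emptyVal (Us ++ σ) A))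
      body⇔ Us = ⇔.trans (sat-imp emptyVal (Us ++ σ) (partitionF (_↑ˡ s)) (iff E A))
                         (→-cong-⇔ (sat-partitionF N (_↑ˡ s) (Us ++ σ)) (sat-iff emptyVal (Us ++ σ) E A))

      module _ (Us : Fin k → Fin N → Bool) {lab : Fin N → Fin k}
               (letters : LetterSets lab ((Us ++ σ) ∘ (_↑ˡ s))) where

        sat-E : SatOn lab (σ ∘ xs) emptyVal emptyVal φ ⇔ Sat₁ N emptyVal (Us ++ σ) E
        sat-E = sat-eraseSymbols letters (λ i → cong-app (sym (lookup-++ʳ Us σ (xs i)))) emptyVal emptyVal φ

        sat-A : Sat₁ N emptyVal (Us ++ σ) A ⇔ accepts D (tabulate lab)
        sat-A = sat-acceptF (_↑ˡ s) (Us ++ σ) letters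

      to′ : (∀ Us → Sat₁ N emptyVal (Us ++ σ) body) → Good N (σ ∘ xs)
      to′ valid lab =
        ⇔.trans (sat-E Us letters)
        (⇔.trans (to (body⇔ Us) (valid Us) (LetterSets⇒IsPartition letters)) (sat-A Us letters))
        where
          Us = indicator lab
          letters = LetterSets-resp (λ a → sym (lookup-++ˡ Us σ a)) (LetterSets-indicator lab)

      from′ : Good N (σ ∘ xs) → ∀ Us → Sat₁ N emptyVal (Us ++ σ) body
      from′ good Us = from (body⇔ Us) λ partition →
        let (lab , letters) = IsPartition⇒LetterSets partition in
        ⇔.trans (⇔.sym (sat-E Us letters)) (⇔.trans (good lab) (⇔.sym (sat-A Us letters)))

  Minimal : ∀ N → (Fin ℓ → Fin N → Bool) → Set
  Minimal N X = Good N X × (∀ Y → Good N Y → ¬ Y ≺ X)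

  improvableF : ∀ {s} → (Fin ℓ → Fin s) → Formula 1 0 0 s
  improvableF {s} xs = exs2 ℓ (and (goodF (_↑ˡ s)) (precedesF (_↑ˡ s) ((ℓ ↑ʳ_) ∘ xs)))

  sat-improvableF : ∀ {s N} (σ : Fin s → Fin N → Bool) xs →
                    Sat₁ N emptyVal σ (improvableF xs) ⇔ (∃[ Y ] Good N Y × Y ≺ σ ∘ xs)
  sat-improvableF {s} σ xs = ⇔.trans (sat-exs2 emptyVal σ ℓ _) (Σ-cong-⇔ λ Ys →
    ⇔.trans (sat-goodF (Ys ++ σ) (_↑ˡ s) ×-⇔ sat-precedesF (_↑ˡ s) ((ℓ ↑ʳ_) ∘ xs) (Ys ++ σ))
      (mk⇔ (λ (good , Y≺X) → Good-resp (ˡ≗ Ys) good , ≺-resp (ˡ≗ Ys) (ʳ≗ Ys) Y≺X)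
           (λ (good , Y≺X) → Good-resp (≗₂-sym (ˡ≗ Ys)) good , ≺-resp (≗₂-sym (ˡ≗ Ys)) (≗₂-sym (ʳ≗ Ys)) Y≺X)))
    where
      ˡ≗ : ∀ Ys → (Ys ++ σ) ∘ (_↑ˡ s) ≗₂ Ys
      ˡ≗ Ys j = cong-app (lookup-++ˡ Ys σ j)
      ʳ≗ : ∀ Ys → (Ys ++ σ) ∘ (ℓ ↑ʳ_) ∘ xs ≗₂ σ ∘ xs
      ʳ≗ Ys j = cong-app (lookup-++ʳ Ys σ (xs j))

  ¬improvable⇔least : ∀ {N} (X : Fin ℓ → Fin N → Bool) →
                      (¬ (∃[ Y ] Good N Y × Y ≺ X)) ⇔ (∀ Y → Good N Y → ¬ Y ≺ X)
  ¬improvable⇔least X = mk⇔ (λ ∄ Y good Y≺X → ∄ (Y , good , Y≺X))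
                            (λ least (Y , good , Y≺X) → least Y good Y≺X)

  Minimal-resp : ∀ {N} {X X′ : Fin ℓ → Fin N → Bool} → X ≗₂ X′ → Minimal N X → Minimal N X′
  Minimal-resp X≗X′ (good , least) =
    Good-resp X≗X′ good , λ Y goodY Y≺X′ → least Y goodY (≺-resp (λ _ _ → refl) (≗₂-sym X≗X′) Y≺X′)

  improvable? : ∀ N (X : Fin ℓ → Fin N → Bool) → Dec (∃[ Y ] Good N Y × Y ≺ X)
  improvable? N X = Dec.map (sat-improvableF X id) (SatOn? blank noPredicates emptyVal X (improvableF id))

  minimal-below : ∀ {N} X → Acc _≺_ X → Good N X → ∃[ X* ] Minimal N X*
  minimal-below {N} X (acc smaller) good with improvable? N X
  ... | yes (Y , goodY , Y≺X) = minimal-below Y (smaller Y≺X) goodY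
  ... | no  ¬improvable       = X , good , to (¬improvable⇔least X) ¬improvable

  minimal-unique : ∀ {N} {X X′ : Fin ℓ → Fin N → Bool} → Minimal N X → Minimal N X′ → X ≗₂ X′
  minimal-unique {X = X} {X′} (good , least) (good′ , least′) with ≺-compare X X′
  ... | inj₁ X≗X′         = X≗X′
  ... | inj₂ (inj₁ X≺X′) = ⊥-elim (least′ X good X≺X′)
  ... | inj₂ (inj₂ X′≺X) = ⊥-elim (least X′ good′ X′≺X)

  minimalF : Fin ℓ → Formula 1 0 1 0
  minimalF i = exs2 ℓ (and (renameFO (λ ()) (and (goodF xs) (neg (improvableF xs)))) (mem zero (i ↑ˡ 0)))
    where xs = _↑ˡ 0

  sat-minimalF : ∀ {N} i x → Sat₁ N (ext x emptyVal) emptyVal (minimalF i) ⇔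
                             (∃[ X ] Minimal N X × X i x ≡ true)
  sat-minimalF {N} i x = ⇔.trans (sat-exs2 (ext x emptyVal) emptyVal ℓ _) (Σ-cong-⇔ λ Xs →
    ⇔.trans (minimal⇔ Xs ×-⇔ ≡-congˡ-⇔ (cong-app (lookup-++ˡ Xs emptyVal i) x))
            (mk⇔ (λ (min , Xix) → Minimal-resp (↑ˡ≗ Xs) min , Xix)
                 (λ (min , Xix) → Minimal-resp (≗₂-sym (↑ˡ≗ Xs)) min , Xix)))
    where
      xs = _↑ˡ 0
      ↑ˡ≗ : ∀ Xs → (Xs ++ emptyVal) ∘ xs ≗₂ Xs
      ↑ˡ≗ Xs j = cong-app (lookup-++ˡ Xs emptyVal j)
      minimalHere = and (goodF xs) (neg (improvableF xs))
      minimal⇔ : ∀ Xs → Sat₁ N (ext x emptyVal) (Xs ++ emptyVal) (renameFO (λ ()) minimalHere) ⇔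
                        Minimal N ((Xs ++ emptyVal) ∘ xs)
      minimal⇔ Xs =
        ⇔.trans (SatOn-renameFO blank noPredicates (λ ()) (ext x emptyVal) (Xs ++ emptyVal) minimalHere)
        (⇔.trans (SatOn-cong (λ _ → refl) (λ ()) (λ ()) (λ _ _ → refl) minimalHere)
        (sat-goodF (Xs ++ emptyVal) xs ×-⇔
         ⇔.trans (¬-cong-⇔ (sat-improvableF (Xs ++ emptyVal) xs)) (¬improvable⇔least _)))

  Minimal-value⇔ : ∀ {N} {X* : Fin ℓ → Fin N → Bool} → Minimal N X* →
                   ∀ i x → (X* i x ≡ true) ⇔ (∃[ X ] Minimal N X × X i x ≡ true)
  Minimal-value⇔ {X* = X*} min* i x =
    mk⇔ (λ X*ix → X* , min* , X*ix) (λ (X , min , Xix) → trans (minimal-unique min* min i x) Xix)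

Sat-tabulate⇔ : ∀ {k ℓ n} (lab : Fin n → Fin k) (P : Fin ℓ → MonPred) (φ : Sentence k ℓ) →
                Sat (tabulate lab) P emptyVal emptyVal φ ⇔ SatOn lab (λ i → P i n) emptyVal emptyVal φ
Sat-tabulate⇔ lab P φ =
  ⇔.trans (Sat⇔SatOn (tabulate lab) P emptyVal emptyVal φ)
  (⇔.trans (SatOn-cast (List.length-tabulate lab) (lookup (tabulate lab)) (λ n i → P i n) emptyVal emptyVal φ)
           (SatOn-cong (List.lookup-tabulate lab) (λ _ _ → refl) (λ ()) (λ ()) φ))

Sat-replicate⇔ : ∀ n (x : Fin n) (ψ : Formula 1 0 1 0) →
                 let n≡ = List.length-replicate n in
                 Sat (replicate n zero) emptyVal (λ _ → Fin.cast (sym n≡) x) emptyVal ψ ⇔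
                 Sat₁ n (ext x emptyVal) emptyVal ψ
Sat-replicate⇔ n x ψ =
  ⇔.trans (Sat⇔SatOn (replicate n zero) emptyVal ρ emptyVal ψ)
  (⇔.trans (SatOn-cast n≡ (lookup (replicate n zero)) (λ m i → emptyVal {B = MonPred} i m) ρ emptyVal ψ)
           (SatOn-cong (λ _ → Fin1-≡-zero _) (λ ()) (λ { zero → Fin.cast-involutive n≡ (sym n≡) x }) (λ ()) ψ))
  where
    n≡ = List.length-replicate n
    ρ = λ _ → Fin.cast (sym n≡) x
    Fin1-≡-zero : (a : Fin 1) → a ≡ zero
    Fin1-≡-zero zero = refl

mainTheorem3 : {k ℓ : ℕ} (φ : Sentence k ℓ) (P : Fin ℓ → MonPred) →
               Regular (Lang φ P) →
               Σ (Fin ℓ → MonPred) λ Q →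
                 ((i : Fin ℓ) → RegularPred (Q i)) ×
                 ((u : Word k) → Lang φ Q u ⇔ Lang φ P u)
mainTheorem3 {ℓ = ℓ} φ P (D , L⇔D) = Q , Q-regular , Q-language
  where
    open Minimisation φ D

    P-good : ∀ n → Good n (λ i → P i n)
    P-good n lab = ⇔.trans (⇔.sym (Sat-tabulate⇔ lab P φ)) (L⇔D (tabulate lab))

    least : ∀ n → ∃[ X* ] Minimal n X*
    least n = minimal-below _ (≺-wellFounded _) (P-good n)

    Q : Fin ℓ → MonPred
    Q i n = proj₁ (least n) i

    Q-good : ∀ n → Good n (λ i → Q i n)
    Q-good n = proj₁ (proj₂ (least n))

    Q-regular : ∀ i → RegularPred (Q i)
    Q-regular i = minimalF i , λ n x →
      ⇔.trans (Minimal-value⇔ (proj₂ (least n)) i x)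
              (⇔.sym (⇔.trans (Sat-replicate⇔ n x (minimalF i)) (sat-minimalF i x)))

    Q-language : ∀ u → Lang φ Q u ⇔ Lang φ P u
    Q-language u =
      ⇔.trans (Sat⇔SatOn u Q emptyVal emptyVal φ)
      (⇔.trans (Q-good (length u) (lookup u))
      (⇔.trans (≡-congˡ-⇔ (cong (DFA.final D ∘ run D (DFA.start D)) (List.tabulate-lookup u)))
               (⇔.sym (L⇔D u))))
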